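{- Let $D_G$ be the derivation of the polynomial ring $\mathbb{Q}[P,N,E,A,D]$ (i.e. $\mathbb{Q}$-linear and satisfying $D_G(uv)=D_G(u)v+uD_G(v)$) determined by $$D_G(P)=PD+NA,\quad D_G(N)=PD+NA,\quad D_G(E)=(A+D)E,\quad D_G(A)=2AD,\quad D_G(D)=2AD.$$ Then for every $n\geqslant 1$, $$D_G^{n-1}(PE+NE)\Big|_{P=A=E=1,\ N=y,\ D=xy}=\sum_{\pi\in\mathfrak{S}_n^B}x^{\operatorname{des}_A(\pi)}y^{\operatorname{des}_B(\pi)}.$$
   Context: $\mathfrak{S}_n^B$ is the hyperoctahedral group of signed permutations $\pi=\pi(1)\cdots\pi(n)$ of $\pm[n]$ (with $\pi(-i)=-\pi(i)$). For $\pi\in\mathfrak{S}_n^B$: $\operatorname{des}_A(\pi)=\#\{i\in\{1,\ldots,n-1\}:\pi(i)>\pi(i+1)\}$ and $\operatorname{des}_B(\pi)=\#\{i\in\{0,\ldots,n-1\}:\pi(i)>\pi(i+1)\}$ with $\pi(0)=0$. $D_G^0$ is the identity. -}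

module Defs where

open import Data.Nat as ℕ using (ℕ; zero; suc; _≡ᵇ_; _∸_)
open import Data.Integer as ℤ using (ℤ; +_; -_; ∣_∣)
open import Data.Rational as ℚ using (ℚ; _/_; 0ℚ; 1ℚ)
open import Data.Fin using (Fin; zero; suc)
open import Data.Vec as Vec using (Vec; []; _∷_; lookup; zipWith; toList)
open import Data.List as List using (List; []; _∷_; _++_; map; concatMap; filter; foldr; upTo; allFin)
open import Data.Product using (_×_; _,_)
open import Data.Bool using (Bool; true; false; if_then_else_; _∧_; not)
open import Relation.Nullary using (does)
open import Function using (_∘_)

-- Polynomials in Q[P,N,E,A,D]
-- Variables are indexed by Fin 5 in the order P, N, E, A, D.
-- A monomial is its exponent vector; a polynomial is a finite formal
-- sum (list) of terms  c · monomial  (repetitions allowed; equality of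
-- polynomials is equality of all coefficients, see coeff5 / coeffXY).

Mono : Set
Mono = Vec ℕ 5

Poly : Set
Poly = List (ℚ × Mono)

ℚ-ofℕ : ℕ → ℚ
ℚ-ofℕ k = (+ k) / 1

var : Fin 5 → Mono
var zero = 1 ∷ 0 ∷ 0 ∷ 0 ∷ 0 ∷ []
var (suc zero) = 0 ∷ 1 ∷ 0 ∷ 0 ∷ 0 ∷ []
var (suc (suc zero)) = 0 ∷ 0 ∷ 1 ∷ 0 ∷ 0 ∷ []
var (suc (suc (suc zero))) = 0 ∷ 0 ∷ 0 ∷ 1 ∷ 0 ∷ []
var (suc (suc (suc (suc zero)))) = 0 ∷ 0 ∷ 0 ∷ 0 ∷ 1 ∷ []

vP vN vE vA vD : Fin 5
vP = zero
vN = suc zero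
vE = suc (suc zero)
vA = suc (suc (suc zero))
vD = suc (suc (suc (suc zero)))

mulMono : Mono → Mono → Mono
mulMono = zipWith ℕ._+_

term2 : ℚ → Fin 5 → Fin 5 → ℚ × Mono
term2 c i j = c , mulMono (var i) (var j)

mulTerm : ℚ × Mono → Poly → Poly
mulTerm (c , m) = map (λ { (c' , m') → (c ℚ.* c' , mulMono m m') })

_⊕_ : Poly → Poly → Poly
_⊕_ = _++_

DGgen : Fin 5 → Poly
DGgen zero = term2 1ℚ vP vD ∷ term2 1ℚ vN vA ∷ []
DGgen (suc zero) = term2 1ℚ vP vD ∷ term2 1ℚ vN vA ∷ []
DGgen (suc (suc zero)) = term2 1ℚ vA vE ∷ term2 1ℚ vD vE ∷ []
DGgen (suc (suc (suc zero))) = term2 (ℚ-ofℕ 2) vA vD ∷ []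
DGgen (suc (suc (suc (suc zero)))) = term2 (ℚ-ofℕ 2) vA vD ∷ []

decAt : Mono → Fin 5 → Mono
decAt m i = Vec.updateAt m i (λ k → k ∸ 1)

-- D_G on a single term c·m, obtained from Q-linearity and the Leibniz rule:
--   D_G(c · ∏ x_i^{k_i}) = Σ_i c · k_i · x_i^{k_i - 1} ∏_{j≠i} x_j^{k_j} · D_G(x_i)
DGterm : ℚ × Mono → Poly
DGterm (c , m) =
  concatMap (λ i → mulTerm (c ℚ.* ℚ-ofℕ (lookup m i) , decAt m i) (DGgen i))
            (allFin 5)

DG : Poly → Poly
DG = concatMap DGterm

iterate : {A : Set} → ℕ → (A → A) → A → A
iterate zero f a = a
iterate (suc n) f a = f (iterate n f a)

PE+NE : Poly
PE+NE = term2 1ℚ vP vE ∷ term2 1ℚ vN vE ∷ []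

PolyXY : Set
PolyXY = List (ℚ × ℕ × ℕ)

coeffXY : PolyXY → ℕ → ℕ → ℚ
coeffXY p i j =
  foldr (λ { (c , a , b) acc →
             if (a ≡ᵇ i) ∧ (b ≡ᵇ j) then c ℚ.+ acc else acc }) 0ℚ p

-- substitution P = A = E = 1, N = y, D = x y :
--   P^p N^n E^e A^a D^d  ↦  x^d y^(n + d)
evalMono : Mono → ℕ × ℕ
evalMono (p ∷ n ∷ e ∷ a ∷ d ∷ []) = d , n ℕ.+ d

evalSubst : Poly → PolyXY
evalSubst = map (λ { (c , m) → (c , evalMono m) })

-- Signed permutations of ±[n], as words π(1)⋯π(n) of nonzero integers
-- in {-n,…,-1,1,…,n} whose absolute values are pairwise distinct.

pm : ℕ → List ℤ
pm n = map (λ k → - (+ suc k)) (upTo n) ++ map (λ k → + suc k) (upTo n)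

words : {A : Set} → List A → (k : ℕ) → List (Vec A k)
words xs zero = [] ∷ []
words xs (suc k) = concatMap (λ x → map (x ∷_) (words xs k)) xs

elemᵇ : ℕ → List ℕ → Bool
elemᵇ x [] = false
elemᵇ x (y ∷ ys) = (x ≡ᵇ y) Data.Bool.∨ elemᵇ x ys

distinct : List ℕ → Bool
distinct [] = true
distinct (x ∷ xs) = not (elemᵇ x xs) ∧ distinct xs

signedPerms : (n : ℕ) → List (Vec ℤ n)
signedPerms n = filter (λ w → Data.Bool._≟_ (distinct (map ∣_∣ (toList w))) true) (words (pm n) n)

desList : List ℤ → ℕ
desList [] = 0
desList (a ∷ []) = 0
desList (a ∷ b ∷ w) = (if does (b ℤ.<? a) then 1 else 0) ℕ.+ desList (b ∷ w)

desA : {n : ℕ} → Vec ℤ n → ℕ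
desA π = desList (toList π)

desB : {n : ℕ} → Vec ℤ n → ℕ
desB π = desList (+ 0 ∷ toList π)

signedDesPoly : ℕ → PolyXY
signedDesPoly n = map (λ π → (1ℚ , desA π , desB π)) (signedPerms n)

-- Pair polynomials with linear functionals ℓ on monomials, ⟨ ℓ , p ⟩ = Σ c · ℓ m.  By the
-- Leibniz rule D_G has a transpose DGᵀ on functionals, and on the monomials
-- P^(1-s) N^s E A^a D^d reachable from PE + NE it acts on the values g a d s of ℓ by an
-- explicit linear operator, transfer.  Reading off the coefficient of x^i y^j after the
-- substitution is such a functional, so the left-hand side is a value of transfer^(n-1) g.
--
-- Weight a signed permutation by g (ascents, descents, first letter negative).  Every signed
-- permutation of [n+1] arises exactly once by inserting n+1 or -(n+1) into one of [n], and
-- inserting a letter larger (smaller) than all others into every position changes these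
-- statistics so that the total weight is again given by transfer.  So both sides satisfy the
-- same recursion and agree for n = 1.

{-# OPTIONS --safe #-}
module Submission where

open import Defs
open import Data.Nat using (ℕ; _≤_; _∸_)
open import Relation.Binary.PropositionalEquality using (_≡_)

open import Data.Bool using (Bool; true; false; if_then_else_; _∧_; _∨_; not; T)
open import Data.Bool.Properties using (∧-zeroʳ; ∨-assoc; ∨-comm; ∨-conicalˡ; ∨-conicalʳ)
import Data.Bool as Bool
open import Data.Fin using (Fin; zero; suc)
open import Data.Integer as ℤ using (ℤ; 0ℤ; +[1+_]; -[1+_]; ∣_∣; +<+; -<+; -<-) renaming (+_ to pos)
import Data.Integer.Properties as ℤ
open import Data.List using (List; []; _∷_; _++_; map; concatMap; filter; allFin; upTo; tabulate)
import Data.List.Properties as List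
open import Data.List.Relation.Unary.All as All using (All; []; _∷_)
import Data.List.Relation.Unary.All.Properties as Allₚ
open import Data.Nat as ℕ using (zero; suc; _≡ᵇ_; _<_; s≤s; z≤n)
import Data.Nat.Coprimality as Coprimality
import Data.Nat.GeneralisedArithmetic as ℕ
import Data.Nat.Properties as ℕ
open import Data.Product using (_×_; _,_; proj₁; proj₂)
open import Data.Rational using (ℚ; 0ℚ; 1ℚ; _+_; _*_; _/_)
open import Data.Rational.Properties
open import Data.Vec using (Vec; []; _∷_; lookup; toList; insertAt)
open import Function using (_∘_)
open import Relation.Binary.PropositionalEquality
  using (refl; sym; trans; cong; cong₂; subst; module ≡-Reasoning)
open import Relation.Nullary using (does)
open import Relation.Nullary.Decidable using (dec-true; dec-false)
open import Relation.Nullary.Decidable.Core using (dec⇒maybe)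
open import Relation.Unary using (Decidable)
open import Tactic.RingSolver using (solve-∀)
open import Tactic.RingSolver.Core.AlmostCommutativeRing using (AlmostCommutativeRing; fromCommutativeRing)

open ≡-Reasoning

private
  variable
    A B : Set

ℚ-ring : AlmostCommutativeRing _ _
ℚ-ring = fromCommutativeRing +-*-commutativeRing (λ x → dec⇒maybe (0ℚ ≟ x))

∑ : List A → (A → ℚ) → ℚ
∑ []       f = 0ℚ
∑ (x ∷ xs) f = f x + ∑ xs f

syntax ∑ xs (λ x → e) = ∑[ x ∈ xs ] e

∑-++ : ∀ (xs ys : List A) f → ∑ (xs ++ ys) f ≡ ∑ xs f + ∑ ys f
∑-++ []       ys f = sym (+-identityˡ _)
∑-++ (x ∷ xs) ys f = trans (cong (f x +_) (∑-++ xs ys f)) (sym (+-assoc (f x) _ _))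

∑-map : ∀ (g : A → B) xs (f : B → ℚ) → ∑ (map g xs) f ≡ ∑ xs (f ∘ g)
∑-map g []       f = refl
∑-map g (x ∷ xs) f = cong (f (g x) +_) (∑-map g xs f)

∑-concatMap : ∀ (g : A → List B) xs (f : B → ℚ) → ∑ (concatMap g xs) f ≡ ∑[ x ∈ xs ] ∑ (g x) f
∑-concatMap g []       f = refl
∑-concatMap g (x ∷ xs) f = trans (∑-++ (g x) _ f) (cong (∑ (g x) f +_) (∑-concatMap g xs f))

∑-cong : ∀ xs {f g : A → ℚ} → (∀ x → f x ≡ g x) → ∑ xs f ≡ ∑ xs g
∑-cong []       f≡g = refl
∑-cong (x ∷ xs) f≡g = cong₂ _+_ (f≡g x) (∑-cong xs f≡g)

∑-cong-All : ∀ {P : A → Set} {xs f g} → All P xs → (∀ x → P x → f x ≡ g x) → ∑ xs f ≡ ∑ xs g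
∑-cong-All []         f≡g = refl
∑-cong-All (px ∷ pxs) f≡g = cong₂ _+_ (f≡g _ px) (∑-cong-All pxs f≡g)

∑-zero : ∀ (xs : List A) → ∑ xs (λ _ → 0ℚ) ≡ 0ℚ
∑-zero []       = refl
∑-zero (x ∷ xs) = trans (+-identityˡ _) (∑-zero xs)

∑-distrib-+ : ∀ xs (f g : A → ℚ) → ∑[ x ∈ xs ] (f x + g x) ≡ ∑ xs f + ∑ xs g
∑-distrib-+ []       f g = sym (+-identityˡ 0ℚ)
∑-distrib-+ (x ∷ xs) f g =
  trans (cong (f x + g x +_) (∑-distrib-+ xs f g)) (+-interchange (f x) (g x) _ _)
  where
  +-interchange : ∀ a b c d → (a + b) + (c + d) ≡ (a + c) + (b + d)
  +-interchange = solve-∀ ℚ-ring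

*-distribˡ-∑ : ∀ c xs (f : A → ℚ) → c * ∑ xs f ≡ ∑[ x ∈ xs ] (c * f x)
*-distribˡ-∑ c []       f = *-zeroʳ c
*-distribˡ-∑ c (x ∷ xs) f = trans (*-distribˡ-+ c (f x) _) (cong (c * f x +_) (*-distribˡ-∑ c xs f))

∑-if : ∀ b xs (f : A → ℚ) → ∑[ x ∈ xs ] (if b then f x else 0ℚ) ≡ (if b then ∑ xs f else 0ℚ)
∑-if true  xs f = refl
∑-if false xs f = ∑-zero xs

∑-comm : ∀ (xs : List A) (ys : List B) (f : A → B → ℚ) →
         ∑[ x ∈ xs ] ∑[ y ∈ ys ] f x y ≡ ∑[ y ∈ ys ] ∑[ x ∈ xs ] f x y
∑-comm []       ys f = sym (∑-zero ys)
∑-comm (x ∷ xs) ys f = trans (cong (∑ ys (f x) +_) (∑-comm xs ys f)) (sym (∑-distrib-+ ys (f x) _))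

∑-filter : ∀ {P : A → Set} (P? : Decidable P) xs f →
           ∑ (filter P? xs) f ≡ ∑[ x ∈ xs ] (if does (P? x) then f x else 0ℚ)
∑-filter P? []       f = refl
∑-filter P? (x ∷ xs) f with does (P? x)
... | true  = cong (f x +_) (∑-filter P? xs f)
... | false = trans (∑-filter P? xs f) (sym (+-identityˡ _))

∑-allFin-suc : ∀ n (f : Fin (suc n) → ℚ) → ∑ (allFin (suc n)) f ≡ f zero + ∑[ i ∈ allFin n ] f (suc i)
∑-allFin-suc n f = cong (f zero +_) (begin
  ∑ (tabulate suc) f          ≡⟨ cong (λ is → ∑ is f) (List.map-tabulate (λ i → i) suc) ⟨
  ∑ (map suc (allFin n)) f    ≡⟨ ∑-map suc (allFin n) f ⟩
  ∑[ i ∈ allFin n ] f (suc i) ∎)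

ℚ-ofℕ-+ : ∀ m n → ℚ-ofℕ (m ℕ.+ n) ≡ ℚ-ofℕ m + ℚ-ofℕ n
-- The middle term is mkℚ (pos m) 0 _ + mkℚ (pos n) 0 _ unfolded.
ℚ-ofℕ-+ m n = begin
  pos (m ℕ.+ n) / 1                          ≡⟨ /-cong numerators refl ⟩
  (pos m ℤ.* pos 1 ℤ.+ pos n ℤ.* pos 1) / 1  ≡⟨ cong₂ _+_ (normalize-coprime (coprime-1 m))
                                                           (normalize-coprime (coprime-1 n)) ⟨
  ℚ-ofℕ m + ℚ-ofℕ n                          ∎
  where
  numerators : pos (m ℕ.+ n) ≡ pos m ℤ.* pos 1 ℤ.+ pos n ℤ.* pos 1
  numerators = trans (ℤ.pos-+ m n) (sym (cong₂ ℤ._+_ (ℤ.*-identityʳ (pos m)) (ℤ.*-identityʳ (pos n))))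

  coprime-1 : ∀ k → Coprimality.Coprime k 1
  coprime-1 k = Coprimality.sym (Coprimality.1-coprimeTo k)

ℚ-ofℕ-suc : ∀ k → ℚ-ofℕ (suc k) ≡ 1ℚ + ℚ-ofℕ k
ℚ-ofℕ-suc = ℚ-ofℕ-+ 1

⟨_,_⟩ : (Mono → ℚ) → Poly → ℚ
⟨ ℓ , p ⟩ = ∑ p (λ (c , m) → c * ℓ m)

⟨⟩-mulTerm : ∀ ℓ c m p → ⟨ ℓ , mulTerm (c , m) p ⟩ ≡ c * ⟨ ℓ ∘ mulMono m , p ⟩
⟨⟩-mulTerm ℓ c m p = begin
  ⟨ ℓ , mulTerm (c , m) p ⟩                          ≡⟨ ∑-map _ p _ ⟩
  ∑ p (λ (c′ , m′) → c * c′ * ℓ (mulMono m m′))      ≡⟨ ∑-cong p (λ (c′ , m′) → *-assoc c c′ _) ⟩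
  ∑ p (λ (c′ , m′) → c * (c′ * ℓ (mulMono m m′)))    ≡⟨ *-distribˡ-∑ c p _ ⟨
  c * ⟨ ℓ ∘ mulMono m , p ⟩                          ∎

DGᵀ : (Mono → ℚ) → Mono → ℚ
DGᵀ ℓ m = ∑[ i ∈ allFin 5 ] (ℚ-ofℕ (lookup m i) * ⟨ ℓ ∘ mulMono (decAt m i) , DGgen i ⟩)

⟨⟩-DGterm : ∀ ℓ c m → ⟨ ℓ , DGterm (c , m) ⟩ ≡ c * DGᵀ ℓ m
⟨⟩-DGterm ℓ c m = begin
  ⟨ ℓ , DGterm (c , m) ⟩
    ≡⟨ ∑-concatMap (λ i → mulTerm (c * k i , decAt m i) (DGgen i)) (allFin 5)
                   (λ (c′ , m′) → c′ * ℓ m′) ⟩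
  ∑[ i ∈ allFin 5 ] ⟨ ℓ , mulTerm (c * k i , decAt m i) (DGgen i) ⟩
    ≡⟨ ∑-cong (allFin 5) (λ i → trans (⟨⟩-mulTerm ℓ (c * k i) (decAt m i) (DGgen i))
                                      (*-assoc c (k i) (∂ i))) ⟩
  ∑[ i ∈ allFin 5 ] (c * (k i * ∂ i))
    ≡⟨ *-distribˡ-∑ c (allFin 5) (λ i → k i * ∂ i) ⟨
  c * DGᵀ ℓ m
    ∎
  where
  k ∂ : Fin 5 → ℚ
  k i = ℚ-ofℕ (lookup m i)
  ∂ i = ⟨ ℓ ∘ mulMono (decAt m i) , DGgen i ⟩

⟨⟩-DG : ∀ ℓ p → ⟨ ℓ , DG p ⟩ ≡ ⟨ DGᵀ ℓ , p ⟩
⟨⟩-DG ℓ p = trans (∑-concatMap DGterm p (λ (c , m) → c * ℓ m))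
                  (∑-cong p (λ (c , m) → ⟨⟩-DGterm ℓ c m))

⟨⟩-iterate-DG : ∀ n ℓ p → ⟨ ℓ , iterate n DG p ⟩ ≡ ⟨ ℕ.iterate DGᵀ ℓ n , p ⟩
⟨⟩-iterate-DG zero    ℓ p = refl
⟨⟩-iterate-DG (suc n) ℓ p = trans (⟨⟩-DG ℓ (iterate n DG p)) (⟨⟩-iterate-DG n (DGᵀ ℓ) p)

coeffAt : ℕ → ℕ → Mono → ℚ
coeffAt i j m = if (proj₁ (evalMono m) ≡ᵇ i) ∧ (proj₂ (evalMono m) ≡ᵇ j) then 1ℚ else 0ℚ

coeffXY-evalSubst : ∀ i j p → coeffXY (evalSubst p) i j ≡ ⟨ coeffAt i j , p ⟩
coeffXY-evalSubst i j []            = refl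
coeffXY-evalSubst i j ((c , m) ∷ p) with (proj₁ (evalMono m) ≡ᵇ i) ∧ (proj₂ (evalMono m) ≡ᵇ j)
... | true  = cong₂ _+_ (sym (*-identityʳ c)) (coeffXY-evalSubst i j p)
... | false = trans (coeffXY-evalSubst i j p) (sym (trans (cong (_+ _) (*-zeroʳ c)) (+-identityˡ _)))

-- g a d s is the weight of the monomial shape s a d = P^(1-s) N^s E A^a D^d, and of the signed
-- permutations with a ascents, d descents and negative first letter iff s.
Weight : Set
Weight = ℕ → ℕ → Bool → ℚ

shape : Bool → ℕ → ℕ → Mono
shape false a d = 1 ∷ 0 ∷ 1 ∷ a ∷ d ∷ []
shape true  a d = 0 ∷ 1 ∷ 1 ∷ a ∷ d ∷ []

onShapes : (Mono → ℚ) → Weight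
onShapes ℓ a d s = ℓ (shape s a d)

transfer : Weight → Weight
transfer g a d s = g a (suc d) false + g (suc a) d true
                 + (1ℚ + ℚ-ofℕ d + ℚ-ofℕ d) * g (suc a) d s
                 + (1ℚ + ℚ-ofℕ a + ℚ-ofℕ a) * g a (suc d) s

transfer-cong : ∀ {g g′ : Weight} → (∀ a d s → g a d s ≡ g′ a d s) →
                ∀ a d s → transfer g a d s ≡ transfer g′ a d s
transfer-cong g≡g′ a d s =
  cong₂ _+_ (cong₂ _+_ (cong₂ _+_ (g≡g′ a (suc d) false) (g≡g′ (suc a) d true))
                       (cong ((1ℚ + ℚ-ofℕ d + ℚ-ofℕ d) *_) (g≡g′ (suc a) d s)))
            (cong ((1ℚ + ℚ-ofℕ a + ℚ-ofℕ a) *_) (g≡g′ a (suc d) s))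

-- At k = 0 the truncated subtraction in decAt leaves a junk exponent, multiplied by 0.
lower-raise : ∀ k (f : ℕ → ℚ) → ℚ-ofℕ k * f (k ∸ 1 ℕ.+ 1) ≡ ℚ-ofℕ k * f k
lower-raise zero    f = trans (*-zeroˡ (f 1)) (sym (*-zeroˡ (f 0)))
lower-raise (suc k) f = cong (λ j → ℚ-ofℕ (suc k) * f j) (ℕ.+-comm k 1)

-- In each expansion the five summands are the contributions of P, N, E, A, D; J is the one
-- of the variable (P or N) with exponent 0.
DGᵀ-shape : ∀ ℓ s a d → DGᵀ ℓ (shape s a d) ≡ transfer (onShapes ℓ) a d s
DGᵀ-shape ℓ false a d
  rewrite lower-raise a (λ a′ → ℚ-ofℕ 2 * ℓ (shape false a′ (d ℕ.+ 1)) + 0ℚ)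
        | lower-raise d (λ d′ → ℚ-ofℕ 2 * ℓ (shape false (a ℕ.+ 1) d′) + 0ℚ)
        | ℕ.+-identityʳ a | ℕ.+-identityʳ d | ℕ.+-comm a 1 | ℕ.+-comm d 1
  = expansion (ℓ (shape false a (suc d))) (ℓ (shape true (suc a) d)) (ℓ (shape false (suc a) d))
              (1ℚ * ℓ (2 ∷ 0 ∷ 1 ∷ a ∷ suc d ∷ []) + (1ℚ * ℓ (1 ∷ 1 ∷ 1 ∷ suc a ∷ d ∷ []) + 0ℚ))
              (ℚ-ofℕ a) (ℚ-ofℕ d)
  where
  expansion : ∀ X Y Z J A D →
    1ℚ * (1ℚ * X + (1ℚ * Y + 0ℚ)) + (0ℚ * J + (1ℚ * (1ℚ * Z + (1ℚ * X + 0ℚ))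
      + (A * (ℚ-ofℕ 2 * X + 0ℚ) + (D * (ℚ-ofℕ 2 * Z + 0ℚ) + 0ℚ))))
    ≡ X + Y + (1ℚ + D + D) * Z + (1ℚ + A + A) * X
  expansion = solve-∀ ℚ-ring
DGᵀ-shape ℓ true a d
  rewrite lower-raise a (λ a′ → ℚ-ofℕ 2 * ℓ (shape true a′ (d ℕ.+ 1)) + 0ℚ)
        | lower-raise d (λ d′ → ℚ-ofℕ 2 * ℓ (shape true (a ℕ.+ 1) d′) + 0ℚ)
        | ℕ.+-identityʳ a | ℕ.+-identityʳ d | ℕ.+-comm a 1 | ℕ.+-comm d 1
  = expansion (ℓ (shape false a (suc d))) (ℓ (shape true (suc a) d)) (ℓ (shape true a (suc d)))
              (1ℚ * ℓ (1 ∷ 1 ∷ 1 ∷ a ∷ suc d ∷ []) + (1ℚ * ℓ (0 ∷ 2 ∷ 1 ∷ suc a ∷ d ∷ []) + 0ℚ))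
              (ℚ-ofℕ a) (ℚ-ofℕ d)
  where
  expansion : ∀ X Y W J A D →
    0ℚ * J + (1ℚ * (1ℚ * X + (1ℚ * Y + 0ℚ)) + (1ℚ * (1ℚ * Y + (1ℚ * W + 0ℚ))
      + (A * (ℚ-ofℕ 2 * W + 0ℚ) + (D * (ℚ-ofℕ 2 * Y + 0ℚ) + 0ℚ))))
    ≡ X + Y + (1ℚ + D + D) * Y + (1ℚ + A + A) * W
  expansion = solve-∀ ℚ-ring

iterate-DGᵀ-shape : ∀ n ℓ g → (∀ a d s → onShapes ℓ a d s ≡ g a d s) →
                    ∀ a d s → onShapes (ℕ.iterate DGᵀ ℓ n) a d s ≡ ℕ.iterate transfer g n a d s
iterate-DGᵀ-shape zero    ℓ g ℓ≡g = ℓ≡g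
iterate-DGᵀ-shape (suc n) ℓ g ℓ≡g =
  iterate-DGᵀ-shape n (DGᵀ ℓ) (transfer g)
    (λ a d s → trans (DGᵀ-shape ℓ s a d) (transfer-cong ℓ≡g a d s))

∑-insert : ∀ {k} → A → Vec A k → (Vec A (suc k) → ℚ) → ℚ
∑-insert {k = k} x w F = ∑[ i ∈ allFin (suc k) ] F (insertAt w i x)

∑-insert-∷ : ∀ {k} x y (w : Vec A k) F →
             ∑-insert x (y ∷ w) F ≡ F (x ∷ y ∷ w) + ∑-insert x w (F ∘ (y ∷_))
∑-insert-∷ x y w F = ∑-allFin-suc _ (λ i → F (insertAt (y ∷ w) i x))

∑-words-suc : ∀ (L : List A) k (G : Vec A (suc k) → ℚ) →
              ∑ (words L (suc k)) G ≡ ∑[ y ∈ L ] ∑[ w ∈ words L k ] G (y ∷ w)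
∑-words-suc L k G = trans (∑-concatMap (λ y → map (y ∷_) (words L k)) L G)
                          (∑-cong L (λ y → ∑-map (y ∷_) (words L k) G))

∑-words-alphabet : ∀ {L L′ : List A} → (∀ f → ∑ L f ≡ ∑ L′ f) →
                   ∀ k G → ∑ (words L k) G ≡ ∑ (words L′ k) G
∑-words-alphabet L≈L′ zero    G = refl
∑-words-alphabet {L = L} {L′} L≈L′ (suc k) G = begin
  ∑ (words L (suc k)) G                       ≡⟨ ∑-words-suc L k G ⟩
  ∑[ y ∈ L ] ∑[ w ∈ words L k ] G (y ∷ w)     ≡⟨ ∑-cong L (λ y → ∑-words-alphabet L≈L′ k (G ∘ (y ∷_))) ⟩
  ∑[ y ∈ L ] ∑[ w ∈ words L′ k ] G (y ∷ w)    ≡⟨ L≈L′ _ ⟩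
  ∑[ y ∈ L′ ] ∑[ w ∈ words L′ k ] G (y ∷ w)   ≡⟨ ∑-words-suc L′ k G ⟨
  ∑ (words L′ (suc k)) G                      ∎

∑-words-cong-All : ∀ {P : A → Set} {L} → All P L → ∀ k {G G′ : Vec A k → ℚ} →
                   (∀ w → All P (toList w) → G w ≡ G′ w) → ∑ (words L k) G ≡ ∑ (words L k) G′
∑-words-cong-All PL zero    G≡G′ = cong (_+ 0ℚ) (G≡G′ [] [])
∑-words-cong-All {L = L} PL (suc k) {G} {G′} G≡G′ = begin
  ∑ (words L (suc k)) G                       ≡⟨ ∑-words-suc L k G ⟩
  ∑[ y ∈ L ] ∑[ w ∈ words L k ] G (y ∷ w)     ≡⟨ ∑-cong-All PL (λ y Py →
                                                   ∑-words-cong-All PL k (λ w Pw → G≡G′ (y ∷ w) (Py ∷ Pw))) ⟩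
  ∑[ y ∈ L ] ∑[ w ∈ words L k ] G′ (y ∷ w)    ≡⟨ ∑-words-suc L k G′ ⟨
  ∑ (words L (suc k)) G′                      ∎

∑-words-insert : ∀ {A : Set} (M : List A) x k (F : Vec A (suc (suc k)) → ℚ) →
  ∑[ w ∈ words M (suc k) ] ∑-insert x w F
  ≡ ∑[ w ∈ words M (suc k) ] F (x ∷ w) + ∑[ y ∈ M ] ∑[ w ∈ words M k ] ∑-insert x w (F ∘ (y ∷_))
∑-words-insert {A} M x k F = begin
  ∑[ w ∈ words M (suc k) ] ∑-insert x w F
    ≡⟨ ∑-words-suc M k (λ w → ∑-insert x w F) ⟩
  ∑[ y ∈ M ] ∑[ w ∈ words M k ] ∑-insert x (y ∷ w) F
    ≡⟨ ∑-cong M (λ y → trans (∑-cong (words M k) (λ w → ∑-insert-∷ x y w F))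
                             (∑-distrib-+ (words M k) _ _)) ⟩
  ∑[ y ∈ M ] (∑[ w ∈ words M k ] F (x ∷ y ∷ w) + behind y)
    ≡⟨ ∑-distrib-+ M _ behind ⟩
  ∑[ y ∈ M ] ∑[ w ∈ words M k ] F (x ∷ y ∷ w) + ∑ M behind
    ≡⟨ cong (_+ ∑ M behind) (∑-words-suc M k (F ∘ (x ∷_))) ⟨
  ∑[ w ∈ words M (suc k) ] F (x ∷ w) + ∑ M behind
    ∎
  where
  behind : A → ℚ
  behind y = ∑[ w ∈ words M k ] ∑-insert x w (F ∘ (y ∷_))

module NewLetters {A : Set} (new : A → Bool) {M N : List A}
                  (M-old : All (λ y → new y ≡ false) M) (N-new : All (λ y → new y ≡ true) N) where

  newCount : ∀ {k} → Vec A k → ℕ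
  newCount []      = 0
  newCount (y ∷ w) = (if new y then 1 else 0) ℕ.+ newCount w

  VanishesFrom : ℕ → ∀ {k} → (Vec A k → ℚ) → Set
  VanishesFrom j G = ∀ w → j ≤ newCount w → G w ≡ 0ℚ

  vanishes-old : ∀ {j k y} {G : Vec A (suc k) → ℚ} →
                 new y ≡ false → VanishesFrom j G → VanishesFrom j (G ∘ (y ∷_))
  vanishes-old {j} old G0 w j≤ =
    G0 (_ ∷ w) (subst (j ≤_) (cong (λ b → (if b then 1 else 0) ℕ.+ newCount w) (sym old)) j≤)

  vanishes-new : ∀ {j k y} {G : Vec A (suc k) → ℚ} →
                 new y ≡ true → VanishesFrom (suc j) G → VanishesFrom j (G ∘ (y ∷_))
  vanishes-new {j} new G0 w j≤ =
    G0 (_ ∷ w) (subst (suc j ≤_) (cong (λ b → (if b then 1 else 0) ℕ.+ newCount w) (sym new)) (s≤s j≤))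

  ∑-words-no-new : ∀ k {G : Vec A k → ℚ} → VanishesFrom 1 G → ∑ (words (M ++ N) k) G ≡ ∑ (words M k) G
  ∑-words-no-new zero    G0 = refl
  ∑-words-no-new (suc k) {G} G0 = begin
    ∑ (words (M ++ N) (suc k)) G
      ≡⟨ trans (∑-words-suc (M ++ N) k G) (∑-++ M N _) ⟩
    ∑[ y ∈ M ] ∑[ w ∈ words (M ++ N) k ] G (y ∷ w) + ∑[ x ∈ N ] ∑[ w ∈ words (M ++ N) k ] G (x ∷ w)
      ≡⟨ cong₂ _+_ (∑-cong-All M-old (λ y old → ∑-words-no-new k (vanishes-old old G0)))
                   (trans (∑-cong-All N-new (λ x new →
                             trans (∑-cong (words (M ++ N) k) (λ w → vanishes-new new G0 w z≤n))
                                   (∑-zero (words (M ++ N) k))))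
                          (∑-zero N)) ⟩
    ∑[ y ∈ M ] ∑[ w ∈ words M k ] G (y ∷ w) + 0ℚ
      ≡⟨ trans (+-identityʳ _) (sym (∑-words-suc M k G)) ⟩
    ∑ (words M (suc k)) G
      ∎

  ∑-words-one-new : ∀ k {F : Vec A (suc k) → ℚ} → VanishesFrom 2 F →
    ∑ (words (M ++ N) (suc k)) F ≡ ∑ (words M (suc k)) F + ∑[ x ∈ N ] ∑[ w ∈ words M k ] ∑-insert x w F
  ∑-words-one-new zero {F} F0 =
    trans (trans (∑-words-suc (M ++ N) 0 F) (∑-++ M N _))
          (cong₂ _+_ (sym (∑-words-suc M 0 F)) (∑-cong N (λ x → sym (+-identityʳ _))))
  ∑-words-one-new (suc k) {F} F0 = begin
    ∑ (words (M ++ N) (suc (suc k))) F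
      ≡⟨ trans (∑-words-suc (M ++ N) (suc k) F) (∑-++ M N _) ⟩
    ∑[ y ∈ M ] ∑[ w ∈ words (M ++ N) (suc k) ] F (y ∷ w)
      + ∑[ x ∈ N ] ∑[ w ∈ words (M ++ N) (suc k) ] F (x ∷ w)
      ≡⟨ cong₂ _+_ (trans (∑-cong-All M-old (λ y old → ∑-words-one-new k (vanishes-old old F0)))
                          (∑-distrib-+ M _ _))
                   (∑-cong-All N-new (λ x new → ∑-words-no-new (suc k) (vanishes-new new F0))) ⟩
    (old + inserted) + front
      ≡⟨ rearrange old inserted front ⟩
    old + (front + inserted)
      ≡⟨ cong₂ _+_ (sym (∑-words-suc M (suc k) F)) front+inserted ⟩
    ∑ (words M (suc (suc k))) F + ∑[ x ∈ N ] ∑[ w ∈ words M (suc k) ] ∑-insert x w F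
      ∎
    where
    old inserted front : ℚ
    old      = ∑[ y ∈ M ] ∑[ w ∈ words M (suc k) ] F (y ∷ w)
    inserted = ∑[ y ∈ M ] ∑[ x ∈ N ] ∑[ w ∈ words M k ] ∑-insert x w (F ∘ (y ∷_))
    front    = ∑[ x ∈ N ] ∑[ w ∈ words M (suc k) ] F (x ∷ w)

    rearrange : ∀ a b c → (a + b) + c ≡ a + (c + b)
    rearrange = solve-∀ ℚ-ring

    front+inserted : front + inserted ≡ ∑[ x ∈ N ] ∑[ w ∈ words M (suc k) ] ∑-insert x w F
    front+inserted = begin
      front + inserted
        ≡⟨ cong (front +_) (∑-comm M N _) ⟩
      front + ∑[ x ∈ N ] ∑[ y ∈ M ] ∑[ w ∈ words M k ] ∑-insert x w (F ∘ (y ∷_))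
        ≡⟨ ∑-distrib-+ N _ _ ⟨
      ∑[ x ∈ N ] (∑[ w ∈ words M (suc k) ] F (x ∷ w)
                  + ∑[ y ∈ M ] ∑[ w ∈ words M k ] ∑-insert x w (F ∘ (y ∷_)))
        ≡⟨ ∑-cong N (λ x → ∑-words-insert M x k F) ⟨
      ∑[ x ∈ N ] ∑[ w ∈ words M (suc k) ] ∑-insert x w F
        ∎

absList : ∀ {k} → Vec ℤ k → List ℕ
absList w = map ∣_∣ (toList w)

distinctAbs : ∀ {k} → Vec ℤ k → Bool
distinctAbs w = distinct (absList w)

elemᵇ-absList-insertAt : ∀ {k} n x (w : Vec ℤ k) i →
  elemᵇ n (absList (insertAt w i x)) ≡ (n ≡ᵇ ∣ x ∣) ∨ elemᵇ n (absList w)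
elemᵇ-absList-insertAt n x w       zero    = refl
elemᵇ-absList-insertAt n x (y ∷ w) (suc i) = begin
  (n ≡ᵇ ∣ y ∣) ∨ elemᵇ n (absList (insertAt w i x))
    ≡⟨ cong ((n ≡ᵇ ∣ y ∣) ∨_) (elemᵇ-absList-insertAt n x w i) ⟩
  (n ≡ᵇ ∣ y ∣) ∨ ((n ≡ᵇ ∣ x ∣) ∨ elemᵇ n (absList w))
    ≡⟨ ∨-swap (n ≡ᵇ ∣ y ∣) (n ≡ᵇ ∣ x ∣) _ ⟩
  (n ≡ᵇ ∣ x ∣) ∨ ((n ≡ᵇ ∣ y ∣) ∨ elemᵇ n (absList w))
    ∎
  where
  ∨-swap : ∀ a b c → a ∨ (b ∨ c) ≡ b ∨ (a ∨ c)
  ∨-swap a b c = trans (sym (∨-assoc a b c)) (trans (cong (_∨ c) (∨-comm a b)) (∨-assoc b a c))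

distinctAbs-insertAt : ∀ {k} x (w : Vec ℤ k) i → elemᵇ ∣ x ∣ (absList w) ≡ false →
                       distinctAbs (insertAt w i x) ≡ distinctAbs w
distinctAbs-insertAt x w       zero    fresh = cong (λ b → not b ∧ distinctAbs w) fresh
distinctAbs-insertAt x (y ∷ w) (suc i) fresh = cong₂ (λ b c → not b ∧ c)
  (trans (elemᵇ-absList-insertAt ∣ y ∣ x w i)
         (cong (_∨ elemᵇ ∣ y ∣ (absList w)) (trans (≡ᵇ-sym ∣ y ∣ ∣ x ∣) (∨-conicalˡ _ _ fresh))))
  (distinctAbs-insertAt x w i (∨-conicalʳ _ _ fresh))
  where
  ≡ᵇ-sym : ∀ a b → (a ≡ᵇ b) ≡ (b ≡ᵇ a)
  ≡ᵇ-sym zero    zero    = refl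
  ≡ᵇ-sym zero    (suc b) = refl
  ≡ᵇ-sym (suc a) zero    = refl
  ≡ᵇ-sym (suc a) (suc b) = ≡ᵇ-sym a b

InRange : ℕ → ℤ → Set
InRange m y = ∣ y ∣ ≤ m

newLetters : ℕ → List ℤ
newLetters m = -[1+ m ] ∷ +[1+ m ] ∷ []

pm-inRange : ∀ m → All (InRange m) (pm m)
pm-inRange m = Allₚ.++⁺ (Allₚ.map⁺ (Allₚ.applyUpTo⁺₁ (λ k → k) m (λ k<m → k<m)))
                        (Allₚ.map⁺ (Allₚ.applyUpTo⁺₁ (λ k → k) m (λ k<m → k<m)))

∑-pm-suc : ∀ m f → ∑ (pm (suc m)) f ≡ ∑ (pm m ++ newLetters m) f
∑-pm-suc m f = begin
  ∑ (map neg (upTo (suc m)) ++ map pos′ (upTo (suc m))) f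
    ≡⟨ trans (∑-++ (map neg (upTo (suc m))) _ f) (cong₂ _+_ (∑-map-upTo-suc neg) (∑-map-upTo-suc pos′)) ⟩
  (∑ (map neg (upTo m)) f + (f -[1+ m ] + 0ℚ)) + (∑ (map pos′ (upTo m)) f + (f +[1+ m ] + 0ℚ))
    ≡⟨ regroup (∑ (map neg (upTo m)) f) (∑ (map pos′ (upTo m)) f) (f -[1+ m ]) (f +[1+ m ]) ⟩
  (∑ (map neg (upTo m)) f + ∑ (map pos′ (upTo m)) f) + ∑ (newLetters m) f
    ≡⟨ cong (_+ ∑ (newLetters m) f) (∑-++ (map neg (upTo m)) _ f) ⟨
  ∑ (pm m) f + ∑ (newLetters m) f
    ≡⟨ ∑-++ (pm m) (newLetters m) f ⟨
  ∑ (pm m ++ newLetters m) f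
    ∎
  where
  neg pos′ : ℕ → ℤ
  neg k  = ℤ.- pos (suc k)
  pos′ k = pos (suc k)

  ∑-map-upTo-suc : ∀ (g : ℕ → ℤ) → ∑ (map g (upTo (suc m))) f ≡ ∑ (map g (upTo m)) f + (f (g m) + 0ℚ)
  ∑-map-upTo-suc g = begin
    ∑ (map g (upTo (suc m))) f             ≡⟨ cong (λ ks → ∑ (map g ks) f) (List.upTo-∷ʳ m) ⟨
    ∑ (map g (upTo m ++ m ∷ [])) f         ≡⟨ cong (λ ys → ∑ ys f) (List.map-++ g (upTo m) (m ∷ [])) ⟩
    ∑ (map g (upTo m) ++ g m ∷ []) f       ≡⟨ ∑-++ (map g (upTo m)) (g m ∷ []) f ⟩
    ∑ (map g (upTo m)) f + (f (g m) + 0ℚ)  ∎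

  regroup : ∀ a b c d → (a + (c + 0ℚ)) + (b + (d + 0ℚ)) ≡ (a + b) + (c + (d + 0ℚ))
  regroup = solve-∀ ℚ-ring

isNew : ℕ → ℤ → Bool
isNew m y = suc m ≡ᵇ ∣ y ∣

isNew-inRange : ∀ {m y} → ∣ y ∣ ≤ m → isNew m y ≡ false
isNew-inRange {m} {y} ∣y∣≤m = dec-false (suc m ℕ.≟ ∣ y ∣) (ℕ.>⇒≢ (s≤s ∣y∣≤m))

isNew-newLetters : ∀ m → All (λ x → isNew m x ≡ true) (newLetters m)
isNew-newLetters m = dec-true (suc m ℕ.≟ suc m) refl ∷ dec-true (suc m ℕ.≟ suc m) refl ∷ []

module Signed (m : ℕ) =
  NewLetters (isNew m) (All.map (λ {y} → isNew-inRange {y = y}) (pm-inRange m)) (isNew-newLetters m)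
open Signed using (newCount; ∑-words-one-new)

elemᵇ-newCount : ∀ m {k} (w : Vec ℤ k) → 1 ≤ newCount m w → elemᵇ (suc m) (absList w) ≡ true
elemᵇ-newCount m (y ∷ w) one with isNew m y
... | true  = refl
... | false = elemᵇ-newCount m w one

distinctAbs-newCount : ∀ m {k} (w : Vec ℤ k) → 2 ≤ newCount m w → distinctAbs w ≡ false
distinctAbs-newCount m (y ∷ w) two with isNew m y in new
... | true  = cong (λ b → not b ∧ distinctAbs w)
                   (subst (λ n → elemᵇ n (absList w) ≡ true)
                          (ℕ.≡ᵇ⇒≡ (suc m) ∣ y ∣ (subst T (sym new) _))
                          (elemᵇ-newCount m w (ℕ.≤-pred two)))
... | false = trans (cong (not (elemᵇ ∣ y ∣ (absList w)) ∧_) (distinctAbs-newCount m w two)) (∧-zeroʳ _)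

elemᵇ-inRange : ∀ {m k} (w : Vec ℤ k) → All (InRange m) (toList w) →
                elemᵇ (suc m) (absList w) ≡ false
elemᵇ-inRange []      []       = refl
elemᵇ-inRange (y ∷ w) (b ∷ bs) = cong₂ _∨_ (isNew-inRange {y = y} b) (elemᵇ-inRange w bs)

∑ᴵ : ℕ → ∀ k → (Vec ℤ k → ℚ) → ℚ
∑ᴵ m k G = ∑[ w ∈ words (pm m) k ] (if distinctAbs w then G w else 0ℚ)

∑ᴵ-cong-inRange : ∀ m k {G G′ : Vec ℤ k → ℚ} → (∀ w → All (InRange m) (toList w) → G w ≡ G′ w) →
                  ∑ᴵ m k G ≡ ∑ᴵ m k G′
∑ᴵ-cong-inRange m k G≡G′ =
  ∑-words-cong-All (pm-inRange m) k (λ w b → cong (λ q → if distinctAbs w then q else 0ℚ) (G≡G′ w b))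

insertNew : ∀ m {k} → (Vec ℤ (suc k) → ℚ) → Vec ℤ k → ℚ
insertNew m G w = ∑[ x ∈ newLetters m ] ∑-insert x w G

∑ᴵ-suc : ∀ m k G → ∑ᴵ (suc m) (suc k) G ≡ ∑ᴵ m (suc k) G + ∑ᴵ m k (insertNew m G)
∑ᴵ-suc m k G = begin
  ∑ᴵ (suc m) (suc k) G
    ≡⟨ ∑-words-alphabet {L = pm (suc m)} {pm m ++ newLetters m} (∑-pm-suc m) (suc k) F ⟩
  ∑ (words (pm m ++ newLetters m) (suc k)) F
    ≡⟨ ∑-words-one-new m k (λ w two → cong (λ b → if b then G w else 0ℚ) (distinctAbs-newCount m w two)) ⟩
  ∑ᴵ m (suc k) G + ∑[ x ∈ newLetters m ] ∑[ w ∈ words (pm m) k ] ∑-insert x w F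
    ≡⟨ cong (∑ᴵ m (suc k) G +_) (trans (∑-comm (newLetters m) (words (pm m) k) (λ x w → ∑-insert x w F))
                                       (∑-words-cong-All (pm-inRange m) k insertNew-distinct)) ⟩
  ∑ᴵ m (suc k) G + ∑ᴵ m k (insertNew m G)
    ∎
  where
  F : Vec ℤ (suc k) → ℚ
  F w = if distinctAbs w then G w else 0ℚ

  insertNew-distinct : ∀ w → All (InRange m) (toList w) →
                       insertNew m F w ≡ (if distinctAbs w then insertNew m G w else 0ℚ)
  insertNew-distinct w bounded = begin
    insertNew m F w
      ≡⟨ ∑-cong-All (fresh ∷ fresh ∷ []) (λ x fresh-x → ∑-cong (allFin (suc k)) (λ i →
           cong (λ b → if b then G (insertAt w i x) else 0ℚ) (distinctAbs-insertAt x w i fresh-x))) ⟩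
    ∑[ x ∈ newLetters m ] ∑[ i ∈ allFin (suc k) ] (if distinctAbs w then G (insertAt w i x) else 0ℚ)
      ≡⟨ ∑-cong (newLetters m) (λ x → ∑-if (distinctAbs w) (allFin (suc k)) (λ i → G (insertAt w i x))) ⟩
    ∑[ x ∈ newLetters m ] (if distinctAbs w then ∑-insert x w G else 0ℚ)
      ≡⟨ ∑-if (distinctAbs w) (newLetters m) (λ x → ∑-insert x w G) ⟩
    (if distinctAbs w then insertNew m G w else 0ℚ)
      ∎
    where
    fresh : elemᵇ (suc m) (absList w) ≡ false
    fresh = elemᵇ-inRange w bounded

-- The pigeonhole principle, from the same decomposition.
∑ᴵ-vanishes : ∀ m k G → m < k → ∑ᴵ m k G ≡ 0ℚ
∑ᴵ-vanishes zero    (suc k) G m<k       = refl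
∑ᴵ-vanishes (suc m) (suc k) G (s≤s m<k) = begin
  ∑ᴵ (suc m) (suc k) G                       ≡⟨ ∑ᴵ-suc m k G ⟩
  ∑ᴵ m (suc k) G + ∑ᴵ m k (insertNew m G)    ≡⟨ cong₂ _+_ (∑ᴵ-vanishes m (suc k) G (ℕ.m<n⇒m<1+n m<k))
                                                           (∑ᴵ-vanishes m k (insertNew m G) m<k) ⟩
  0ℚ + 0ℚ                                    ≡⟨ +-identityˡ 0ℚ ⟩
  0ℚ                                         ∎

∑ᴵ-suc-diagonal : ∀ m G → ∑ᴵ (suc m) (suc m) G ≡ ∑ᴵ m m (insertNew m G)
∑ᴵ-suc-diagonal m G = begin
  ∑ᴵ (suc m) (suc m) G                       ≡⟨ ∑ᴵ-suc m m G ⟩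
  ∑ᴵ m (suc m) G + ∑ᴵ m m (insertNew m G)    ≡⟨ cong (_+ ∑ᴵ m m (insertNew m G))
                                                      (∑ᴵ-vanishes m (suc m) G (ℕ.n<1+n m)) ⟩
  0ℚ + ∑ᴵ m m (insertNew m G)                ≡⟨ +-identityˡ _ ⟩
  ∑ᴵ m m (insertNew m G)                     ∎

ascents : List ℤ → ℕ
ascents []          = 0
ascents (a ∷ [])    = 0
ascents (a ∷ b ∷ w) = (if does (b ℤ.<? a) then 0 else 1) ℕ.+ ascents (b ∷ w)

atAscDes : (ℕ → ℕ → ℚ) → List ℤ → ℚ
atAscDes h l = h (ascents l) (desList l)

shift : Bool → (ℕ → ℕ → ℚ) → ℕ → ℕ → ℚ
shift b h a d = h ((if b then 0 else 1) ℕ.+ a) ((if b then 1 else 0) ℕ.+ d)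

atAscDes-peak : ∀ {x y z} l h → y ℤ.< x → z ℤ.< x →
                atAscDes h (y ∷ x ∷ z ∷ l) ≡ h (suc (ascents (z ∷ l))) (suc (desList (z ∷ l)))
atAscDes-peak {x} {y} {z} l h y<x z<x
  rewrite dec-false (x ℤ.<? y) (ℤ.<-asym y<x) | dec-true (z ℤ.<? x) z<x = refl

atAscDes-valley : ∀ {x y z} l h → x ℤ.< y → x ℤ.< z →
                  atAscDes h (y ∷ x ∷ z ∷ l) ≡ h (suc (ascents (z ∷ l))) (suc (desList (z ∷ l)))
atAscDes-valley {x} {y} {z} l h x<y x<z
  rewrite dec-true (x ℤ.<? y) x<y | dec-false (z ℤ.<? x) (ℤ.<-asym x<z) = refl

private
  absorb-descent : ∀ X Y D A → X + (D * X + A * Y) ≡ (1ℚ + D) * X + A * Y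
  absorb-descent = solve-∀ ℚ-ring

  absorb-ascent : ∀ X Z D A → X + (D * Z + A * X) ≡ D * Z + (1ℚ + A) * X
  absorb-ascent = solve-∀ ℚ-ring

absorb-max : ∀ b a d h →
  h (suc a) (suc d) + (ℚ-ofℕ (suc d) * shift b h (suc a) d + ℚ-ofℕ a * shift b h a (suc d))
  ≡ ℚ-ofℕ (suc ((if b then 1 else 0) ℕ.+ d))
      * h (suc ((if b then 0 else 1) ℕ.+ a)) ((if b then 1 else 0) ℕ.+ d)
    + ℚ-ofℕ ((if b then 0 else 1) ℕ.+ a)
      * h ((if b then 0 else 1) ℕ.+ a) (suc ((if b then 1 else 0) ℕ.+ d))
absorb-max true  a d h = let X = h (suc a) (suc d); Y = h a (suc (suc d)) in
  trans (absorb-descent X Y (ℚ-ofℕ (suc d)) (ℚ-ofℕ a))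
        (cong (λ c → c * X + ℚ-ofℕ a * Y) (sym (ℚ-ofℕ-suc (suc d))))
absorb-max false a d h = let X = h (suc a) (suc d); Z = h (suc (suc a)) d in
  trans (absorb-ascent X Z (ℚ-ofℕ (suc d)) (ℚ-ofℕ a))
        (cong (λ c → ℚ-ofℕ (suc d) * Z + c * X) (sym (ℚ-ofℕ-suc a)))

absorb-min : ∀ b a d h →
  h (suc a) (suc d) + (ℚ-ofℕ d * shift b h (suc a) d + ℚ-ofℕ (suc a) * shift b h a (suc d))
  ≡ ℚ-ofℕ ((if b then 1 else 0) ℕ.+ d)
      * h (suc ((if b then 0 else 1) ℕ.+ a)) ((if b then 1 else 0) ℕ.+ d)
    + ℚ-ofℕ (suc ((if b then 0 else 1) ℕ.+ a))
      * h ((if b then 0 else 1) ℕ.+ a) (suc ((if b then 1 else 0) ℕ.+ d))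
absorb-min true  a d h = let X = h (suc a) (suc d); Y = h a (suc (suc d)) in
  trans (absorb-descent X Y (ℚ-ofℕ d) (ℚ-ofℕ (suc a)))
        (cong (λ c → c * X + ℚ-ofℕ (suc a) * Y) (sym (ℚ-ofℕ-suc d)))
absorb-min false a d h = let X = h (suc a) (suc d); Z = h (suc (suc a)) d in
  trans (absorb-ascent X Z (ℚ-ofℕ d) (ℚ-ofℕ (suc a)))
        (cong (λ c → ℚ-ofℕ d * Z + c * X) (sym (ℚ-ofℕ-suc (suc a))))

∑-insert-max : ∀ {k} x y (w : Vec ℤ k) → All (ℤ._< x) (y ∷ toList w) → ∀ h →
  let a = ascents (y ∷ toList w); d = desList (y ∷ toList w) in
  ∑-insert x w (λ v → atAscDes h (y ∷ toList v)) ≡ ℚ-ofℕ (suc d) * h (suc a) d + ℚ-ofℕ a * h a (suc d)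
∑-insert-max x y [] (y<x ∷ []) h rewrite dec-false (x ℤ.<? y) (ℤ.<-asym y<x) = single (h 1 0) (h 0 1)
  where
  single : ∀ X Y → X + 0ℚ ≡ 1ℚ * X + 0ℚ * Y
  single = solve-∀ ℚ-ring
∑-insert-max x y (z ∷ w) (y<x ∷ z<x ∷ w<x) h =
  trans (∑-insert-∷ x z w (λ v → atAscDes h (y ∷ toList v)))
  (trans (cong₂ _+_ (atAscDes-peak (toList w) h y<x z<x)
                    (∑-insert-max x z w (z<x ∷ w<x) (shift (does (z ℤ.<? y)) h)))
         (absorb-max (does (z ℤ.<? y)) (ascents (z ∷ toList w)) (desList (z ∷ toList w)) h))

∑-insert-min : ∀ {k} x y (w : Vec ℤ k) → All (x ℤ.<_) (y ∷ toList w) → ∀ h →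
  let a = ascents (y ∷ toList w); d = desList (y ∷ toList w) in
  ∑-insert x w (λ v → atAscDes h (y ∷ toList v)) ≡ ℚ-ofℕ d * h (suc a) d + ℚ-ofℕ (suc a) * h a (suc d)
∑-insert-min x y [] (x<y ∷ []) h rewrite dec-true (x ℤ.<? y) x<y = single (h 1 0) (h 0 1)
  where
  single : ∀ X Y → Y + 0ℚ ≡ 0ℚ * X + 1ℚ * Y
  single = solve-∀ ℚ-ring
∑-insert-min x y (z ∷ w) (x<y ∷ x<z ∷ x<w) h =
  trans (∑-insert-∷ x z w (λ v → atAscDes h (y ∷ toList v)))
  (trans (cong₂ _+_ (atAscDes-valley (toList w) h x<y x<z)
                    (∑-insert-min x z w (x<z ∷ x<w) (shift (does (z ℤ.<? y)) h)))
         (absorb-min (does (z ℤ.<? y)) (ascents (z ∷ toList w)) (desList (z ∷ toList w)) h))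

∣y∣≤m⇒y<+[1+m] : ∀ {m y} → ∣ y ∣ ≤ m → y ℤ.< +[1+ m ]
∣y∣≤m⇒y<+[1+m] {y = pos k}    k≤m = +<+ (s≤s k≤m)
∣y∣≤m⇒y<+[1+m] {y = -[1+ k ]} _   = -<+

∣y∣≤m⇒-[1+m]<y : ∀ {m y} → ∣ y ∣ ≤ m → -[1+ m ] ℤ.< y
∣y∣≤m⇒-[1+m]<y {y = pos k}    _   = -<+
∣y∣≤m⇒-[1+m]<y {y = -[1+ k ]} k<m = -<- k<m

weight : Weight → ∀ {k} → Vec ℤ (suc k) → ℚ
weight g (y ∷ w) = atAscDes (λ a d → g a d (does (y ℤ.<? 0ℤ))) (y ∷ toList w)

insertNew-weight : ∀ m g {k} (w : Vec ℤ (suc k)) → All (InRange m) (toList w) →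
                   insertNew m (weight g) w ≡ weight (transfer g) w
insertNew-weight m g (y ∷ w) bounded@(∣y∣≤m ∷ _) = begin
  insertNew m (weight g) (y ∷ w)
    ≡⟨ cong₂ (λ u v → u + (v + 0ℚ)) (∑-insert-∷ -[1+ m ] y w (weight g))
                                     (∑-insert-∷ +[1+ m ] y w (weight g)) ⟩
  (weight g (-[1+ m ] ∷ y ∷ w) + ∑-insert -[1+ m ] w (λ v → atAscDes h (y ∷ toList v)))
    + ((weight g (+[1+ m ] ∷ y ∷ w) + ∑-insert +[1+ m ] w (λ v → atAscDes h (y ∷ toList v))) + 0ℚ)
    ≡⟨ cong₂ (λ u v → u + (v + 0ℚ))
         (cong₂ _+_ front-min
                    (∑-insert-min -[1+ m ] y w (All.map (λ {y} → ∣y∣≤m⇒-[1+m]<y {y = y}) bounded) h))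
         (cong₂ _+_ front-max
                    (∑-insert-max +[1+ m ] y w (All.map (λ {y} → ∣y∣≤m⇒y<+[1+m] {y = y}) bounded) h)) ⟩
  (g (suc a) d true + (ℚ-ofℕ d * h (suc a) d + ℚ-ofℕ (suc a) * h a (suc d)))
    + ((g a (suc d) false + (ℚ-ofℕ (suc d) * h (suc a) d + ℚ-ofℕ a * h a (suc d))) + 0ℚ)
    ≡⟨ cong₂ (λ α δ → (g (suc a) d true + (ℚ-ofℕ d * h (suc a) d + α * h a (suc d)))
                      + ((g a (suc d) false + (δ * h (suc a) d + ℚ-ofℕ a * h a (suc d))) + 0ℚ))
             (ℚ-ofℕ-suc a) (ℚ-ofℕ-suc d) ⟩
  (g (suc a) d true + (ℚ-ofℕ d * h (suc a) d + (1ℚ + ℚ-ofℕ a) * h a (suc d)))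
    + ((g a (suc d) false + ((1ℚ + ℚ-ofℕ d) * h (suc a) d + ℚ-ofℕ a * h a (suc d))) + 0ℚ)
    ≡⟨ collect (g (suc a) d true) (g a (suc d) false) (h (suc a) d) (h a (suc d)) (ℚ-ofℕ a) (ℚ-ofℕ d) ⟩
  transfer g a d s
    ∎
  where
  s = does (y ℤ.<? 0ℤ)
  a = ascents (y ∷ toList w)
  d = desList (y ∷ toList w)

  h : ℕ → ℕ → ℚ
  h a d = g a d s

  front-min : weight g (-[1+ m ] ∷ y ∷ w) ≡ g (suc a) d true
  front-min rewrite dec-false (y ℤ.<? -[1+ m ]) (ℤ.<-asym (∣y∣≤m⇒-[1+m]<y ∣y∣≤m)) = refl

  front-max : weight g (+[1+ m ] ∷ y ∷ w) ≡ g a (suc d) false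
  front-max rewrite dec-true (y ℤ.<? +[1+ m ]) (∣y∣≤m⇒y<+[1+m] ∣y∣≤m) = refl

  collect : ∀ T F H₁ H₂ A D →
    (T + (D * H₁ + (1ℚ + A) * H₂)) + ((F + ((1ℚ + D) * H₁ + A * H₂)) + 0ℚ)
    ≡ F + T + (1ℚ + D + D) * H₁ + (1ℚ + A + A) * H₂
  collect = solve-∀ ℚ-ring

∑ᴵ-weight : ∀ n g → ∑ᴵ (suc n) (suc n) (weight g)
                    ≡ ℕ.iterate transfer g n 0 0 false + ℕ.iterate transfer g n 0 0 true
∑ᴵ-weight zero    g = swap (g 0 0 false) (g 0 0 true)
  where
  swap : ∀ X Y → Y + (X + 0ℚ) ≡ X + Y
  swap = solve-∀ ℚ-ring
∑ᴵ-weight (suc n) g = begin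
  ∑ᴵ (suc (suc n)) (suc (suc n)) (weight g)
    ≡⟨ ∑ᴵ-suc-diagonal (suc n) (weight g) ⟩
  ∑ᴵ (suc n) (suc n) (insertNew (suc n) (weight g))
    ≡⟨ ∑ᴵ-cong-inRange (suc n) (suc n) (insertNew-weight (suc n) g) ⟩
  ∑ᴵ (suc n) (suc n) (weight (transfer g))
    ≡⟨ ∑ᴵ-weight n (transfer g) ⟩
  ℕ.iterate transfer g (suc n) 0 0 false + ℕ.iterate transfer g (suc n) 0 0 true
    ∎


coeffXY-map : ∀ (f : A → ℕ × ℕ) xs i j →
  coeffXY (map (λ x → (1ℚ , f x)) xs) i j
  ≡ ∑[ x ∈ xs ] (if (proj₁ (f x) ≡ᵇ i) ∧ (proj₂ (f x) ≡ᵇ j) then 1ℚ else 0ℚ)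
coeffXY-map f []       i j = refl
coeffXY-map f (x ∷ xs) i j with (proj₁ (f x) ≡ᵇ i) ∧ (proj₂ (f x) ≡ᵇ j)
... | true  = cong (1ℚ +_) (coeffXY-map f xs i j)
... | false = trans (coeffXY-map f xs i j) (sym (+-identityˡ _))

coeffXY-signedDesPoly : ∀ n i j →
  coeffXY (signedDesPoly n) i j ≡ ∑ᴵ n n (λ π → if (desA π ≡ᵇ i) ∧ (desB π ≡ᵇ j) then 1ℚ else 0ℚ)
coeffXY-signedDesPoly n i j =
  trans (coeffXY-map (λ π → desA π , desB π) (signedPerms n) i j)
  (trans (∑-filter (λ w → distinctAbs w Bool.≟ true) (words (pm n) n) _)
         (∑-cong (words (pm n) n) (λ w →
            cong (λ b → if b then indicator w else 0ℚ) (does-≟-true (distinctAbs w)))))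
  where
  indicator : Vec ℤ n → ℚ
  indicator π = if (desA π ≡ᵇ i) ∧ (desB π ≡ᵇ j) then 1ℚ else 0ℚ

  does-≟-true : ∀ b → does (b Bool.≟ true) ≡ b
  does-≟-true true  = refl
  does-≟-true false = refl

weight-coeffAt : ∀ i j {k} (π : Vec ℤ (suc k)) →
  (if (desA π ≡ᵇ i) ∧ (desB π ≡ᵇ j) then 1ℚ else 0ℚ) ≡ weight (onShapes (coeffAt i j)) π
weight-coeffAt i j (y ∷ w) with does (y ℤ.<? 0ℤ)
... | true  = refl
... | false = refl

lemma1 : (n : ℕ) → 1 ≤ n → (i j : ℕ) →
    coeffXY (evalSubst (iterate (n ∸ 1) DG PE+NE)) i j ≡ coeffXY (signedDesPoly n) i j
lemma1 (suc n) _ i j = begin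
  coeffXY (evalSubst (iterate n DG PE+NE)) i j
    ≡⟨ coeffXY-evalSubst i j (iterate n DG PE+NE) ⟩
  ⟨ coeffAt i j , iterate n DG PE+NE ⟩
    ≡⟨ ⟨⟩-iterate-DG n (coeffAt i j) PE+NE ⟩
  ⟨ ℓ , PE+NE ⟩
    ≡⟨ unit-coefficients (ℓ (shape false 0 0)) (ℓ (shape true 0 0)) ⟩
  onShapes ℓ 0 0 false + onShapes ℓ 0 0 true
    ≡⟨ cong₂ _+_ (iterate-DGᵀ-shape n _ g (λ _ _ _ → refl) 0 0 false)
                 (iterate-DGᵀ-shape n _ g (λ _ _ _ → refl) 0 0 true) ⟩
  ℕ.iterate transfer g n 0 0 false + ℕ.iterate transfer g n 0 0 true
    ≡⟨ ∑ᴵ-weight n g ⟨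
  ∑ᴵ (suc n) (suc n) (weight g)
    ≡⟨ ∑ᴵ-cong-inRange (suc n) (suc n) (λ π _ → weight-coeffAt i j π) ⟨
  ∑ᴵ (suc n) (suc n) (λ π → if (desA π ≡ᵇ i) ∧ (desB π ≡ᵇ j) then 1ℚ else 0ℚ)
    ≡⟨ coeffXY-signedDesPoly (suc n) i j ⟨
  coeffXY (signedDesPoly (suc n)) i j
    ∎
  where
  g : Weight
  g = onShapes (coeffAt i j)

  ℓ : Mono → ℚ
  ℓ = ℕ.iterate DGᵀ (coeffAt i j) n

  unit-coefficients : ∀ X Y → 1ℚ * X + (1ℚ * Y + 0ℚ) ≡ X + Y
  unit-coefficients = solve-∀ ℚ-ring
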